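{- Let $n$ be a power of two and let $A=(a_0,\dots,a_{n-1})$ be an integer array with $|a_m-a_{m+1}|=1$ for all $0\le m<n-1$. Let $0\le i<n$ and let $x$ be an integer with $a_0-n<x<a_i$. Set $d=a_i-x$, suppose that $d>f(i)$, and let $k=\mathrm{LCA}_{BT}(i-d+1,i)$. Then $0<a_k-x\le f(k)$.
   Context: Define $f(0)=n$ and, for $0<m<n$, $f(m)=3\cdot 2^{\rho(m)}$. Here $\rho(m)$ is the position of the rightmost nonzero bit in the binary representation of $m$, counting from $0$. $\mathrm{LCA}_{BT}(p,q)$ denotes the lowest common ancestor of nodes $p$ and $q$ in the complete balanced binary tree with $n-1$ nodes numbered $1,\dots,n-1$ in symmetric (in-order) order. By convention, $\mathrm{LCA}_{BT}(p,q)=0$ when $p\le 0<q$. -}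

module Defs where

open import Data.Nat using (ℕ; zero; suc; _+_; _*_; _^_; _<ᵇ_)
open import Data.Nat.DivMod using (_/_; _%_)
open import Data.Bool using (Bool; true; false; if_then_else_)
open import Data.Integer using (ℤ; +_; -[1+_]; ∣_∣)

-- number of trailing zero bits of m, computed with fuel (fuel = m suffices for m > 0)
trailingZeros : ℕ → ℕ → ℕ
trailingZeros zero m = 0
trailingZeros (suc fuel) zero = 0
trailingZeros (suc fuel) (suc m) with (suc m) % 2
... | zero = suc (trailingZeros fuel ((suc m) / 2))
... | suc _ = 0

ρ : ℕ → ℕ
ρ m = trailingZeros m m

f : ℕ → ℕ → ℕ
f n zero = n
f n (suc m) = 3 * 2 ^ ρ (suc m)

-- Complete balanced binary tree of height h (2^h - 1 nodes) whose nodes are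
-- o+1, …, o+2^h-1 numbered in symmetric (in-order) order: the root is o + 2^(h-1),
-- the left subtree has offset o and height h-1, the right subtree offset o + 2^(h-1).
-- lcaT h o p q is the lowest common ancestor of nodes p ≤ q of that tree.
lcaT : ℕ → ℕ → ℕ → ℕ → ℕ
lcaT zero o p q = 0
lcaT (suc h) o p q =
  if q <ᵇ (o + 2 ^ h) then lcaT h o p q
  else if (o + 2 ^ h) <ᵇ p then lcaT h (o + 2 ^ h) p q
  else o + 2 ^ h

-- LCA_BT(p,q) in the tree with n - 1 = 2^h - 1 nodes 1..n-1 (for 1 ≤ p ≤ q ≤ n-1),
-- with the convention LCA_BT(p,q) = 0 when p ≤ 0 < q.
LCA-BT : ℕ → ℤ → ℕ → ℕ
LCA-BT h (+ zero) q = 0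
LCA-BT h -[1+ _ ] q = 0
LCA-BT h (+ suc p) q = lcaT h 0 (suc p) q

-- A ±1 sequence is 1-Lipschitz, so a_k − x differs from d = a_i − x by at most i − k.
-- If i − d + 1 > 0, the lowest common ancestor k of i − d + 1 and i lies in [i − d + 1, i]
-- and is a node 2^j (2c+1) whose subtree (2^j · 2c, 2^j · (2c+2)) contains that interval;
-- hence i − k < d, i − k < 2^j and d < 2^(j+1), so 0 < a_k − x < 3 · 2^j = f(k).
-- Otherwise k = 0, and a_0 − x < n is the hypothesis on x.
module Submission where

open import Defs
open import Data.Nat using (ℕ; suc; _^_)
open import Data.Integer using (ℤ; +_; _+_; _-_; _<_; _≤_; ∣_∣)
open import Relation.Binary.PropositionalEquality using (_≡_)
open import Data.Product using (_×_)
import Data.Nat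

open import Data.Nat using (zero; _*_; _∸_; _<ᵇ_; z≤n; s≤s; _<?_)
  renaming (_+_ to _+ℕ_; _<_ to _<ℕ_; _≤_ to _≤ℕ_)
import Data.Nat.Properties as ℕP
open import Data.Nat.DivMod using (_/_; _%_; [m+kn]%n≡m%n; m*n%n≡0; m*n/n≡m)
open import Data.Nat.Tactic.RingSolver using (solve-∀)
import Data.Integer as ℤ
import Data.Integer.Properties as ℤP
import Data.Integer.Tactic.RingSolver as ℤSolver
open import Data.Product using (_,_; proj₁; proj₂)
open import Data.Bool using (true; false)
open import Relation.Nullary using (yes; no; contradiction)
open import Relation.Nullary.Reflects using (ofʸ; ofⁿ)
open import Relation.Binary.PropositionalEquality using (refl; sym; trans; cong; subst; subst₂)

[1+2*c]%2≡1 : ∀ c → suc (2 * c) % 2 ≡ 1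
[1+2*c]%2≡1 c = trans (cong (λ m → suc m % 2) (ℕP.*-comm 2 c)) ([m+kn]%n≡m%n 1 c 2)

2*m%2≡0 : ∀ m → 2 * m % 2 ≡ 0
2*m%2≡0 m = trans (cong (_% 2) (ℕP.*-comm 2 m)) (m*n%n≡0 m 2)

2*m/2≡m : ∀ m → 2 * m / 2 ≡ m
2*m/2≡m m = trans (cong (_/ 2) (ℕP.*-comm 2 m)) (m*n/n≡m m 2)

trailingZeros-odd : ∀ fuel c → trailingZeros (suc fuel) (suc (2 * c)) ≡ 0
trailingZeros-odd fuel c rewrite [1+2*c]%2≡1 c = refl

trailingZeros-double : ∀ fuel {m} → 0 <ℕ m →
                       trailingZeros (suc fuel) (2 * m) ≡ suc (trailingZeros fuel m)
trailingZeros-double fuel {m@(suc _)} _ rewrite 2*m%2≡0 m | 2*m/2≡m m = refl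

n<2^n : ∀ n → n <ℕ 2 ^ n
n<2^n zero = s≤s z≤n
n<2^n (suc n) = begin-strict
  suc n             ≤⟨ n<2^n n ⟩
  2 ^ n             <⟨ ℕP.m<m+n (2 ^ n) (ℕP.m^n>0 2 n) ⟩
  2 ^ n +ℕ 2 ^ n    ≡⟨ cong (2 ^ n +ℕ_) (sym (ℕP.+-identityʳ (2 ^ n))) ⟩
  2 ^ suc n         ∎
  where open ℕP.≤-Reasoning

2^j*[1+2c]>0 : ∀ j c → 0 <ℕ 2 ^ j * suc (2 * c)
2^j*[1+2c]>0 j c = ℕP.*-mono-≤ (ℕP.m^n>0 2 j) (s≤s z≤n)

trailingZeros-2^j*[1+2c] : ∀ fuel j c → j <ℕ fuel → trailingZeros fuel (2 ^ j * suc (2 * c)) ≡ j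
trailingZeros-2^j*[1+2c] (suc fuel) zero c _ =
  subst (λ m → trailingZeros (suc fuel) m ≡ 0) (sym (ℕP.*-identityˡ _)) (trailingZeros-odd fuel c)
trailingZeros-2^j*[1+2c] (suc fuel) (suc j) c (s≤s j<fuel)
  rewrite ℕP.*-assoc 2 (2 ^ j) (suc (2 * c)) =
  trans (trailingZeros-double fuel (2^j*[1+2c]>0 j c))
        (cong suc (trailingZeros-2^j*[1+2c] fuel j c j<fuel))

ρ-2^j*[1+2c] : ∀ j c → ρ (2 ^ j * suc (2 * c)) ≡ j
ρ-2^j*[1+2c] j c = trailingZeros-2^j*[1+2c] _ j c (ℕP.<-≤-trans (n<2^n j) 2^j≤2^j*[1+2c])
  where
  2^j≤2^j*[1+2c] : 2 ^ j ≤ℕ 2 ^ j * suc (2 * c)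
  2^j≤2^j*[1+2c] = ℕP.m≤m*n (2 ^ j) (suc (2 * c))

f-pos : ∀ n {m} → 0 <ℕ m → f n m ≡ 3 * 2 ^ ρ m
f-pos n {suc m} _ = refl

f-2^j*[1+2c] : ∀ n j c → f n (2 ^ j * suc (2 * c)) ≡ 3 * 2 ^ j
f-2^j*[1+2c] n j c =
  trans (f-pos n (2^j*[1+2c]>0 j c)) (cong (λ e → 3 * 2 ^ e) (ρ-2^j*[1+2c] j c))

-- In the in-order numbering, node 2^j (2c+1) is the root of the subtree whose nodes
-- are the integers strictly between 2^j · 2c and 2^j · (2c+2).
record SplitNode (p q k : ℕ) : Set where
  field
    level index : ℕ
    node    : k ≡ 2 ^ level * suc (2 * index)
    left<p  : 2 ^ level * (2 * index) <ℕ p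
    p≤k     : p ≤ℕ k
    k≤q     : k ≤ℕ q
    q<right : q <ℕ 2 ^ level * (2 * index) +ℕ 2 ^ suc level

[2p]c≡p[2c] : ∀ p c → 2 * p * c ≡ p * (2 * c)
[2p]c≡p[2c] = solve-∀

[2p]c+p≡p[1+2c] : ∀ p c → 2 * p * c +ℕ p ≡ p * suc (2 * c)
[2p]c+p≡p[1+2c] = solve-∀

o+2p≡[o+p]+p : ∀ o p → o +ℕ 2 * p ≡ (o +ℕ p) +ℕ p
o+2p≡[o+p]+p = solve-∀

lcaT-splitNode : ∀ h c {o p q} → o ≡ 2 ^ h * c → o <ℕ p → p ≤ℕ q → q <ℕ o +ℕ 2 ^ h →
                 SplitNode p q (lcaT h o p q)
lcaT-splitNode zero c {o} {q = q} o≡ o<p p≤q q<o+1 =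
  contradiction (ℕP.<-≤-trans o<p p≤q) (ℕP.≤⇒≯ (ℕP.m<1+n⇒m≤n (subst (q <ℕ_) (ℕP.+-comm o 1) q<o+1)))
lcaT-splitNode (suc h) c {o} {p} {q} o≡ o<p p≤q q<right
  with q <ᵇ o +ℕ 2 ^ h | ℕP.<ᵇ-reflects-< q (o +ℕ 2 ^ h)
     | o +ℕ 2 ^ h <ᵇ p | ℕP.<ᵇ-reflects-< (o +ℕ 2 ^ h) p
... | true  | ofʸ q<mid | _ | _ =
  lcaT-splitNode h (2 * c) (trans o≡ ([2p]c≡p[2c] (2 ^ h) c)) o<p p≤q q<mid
... | false | ofⁿ _ | true | ofʸ mid<p =
  lcaT-splitNode h (suc (2 * c)) (trans (cong (_+ℕ 2 ^ h) o≡) ([2p]c+p≡p[1+2c] (2 ^ h) c))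
    mid<p p≤q (subst (q <ℕ_) (o+2p≡[o+p]+p o (2 ^ h)) q<right)
... | false | ofⁿ q≮mid | false | ofⁿ mid≮p = record
  { level = h ; index = c
  ; node = trans (cong (_+ℕ 2 ^ h) o≡) ([2p]c+p≡p[1+2c] (2 ^ h) c)
  ; left<p = subst (_<ℕ p) left≡ o<p
  ; p≤k = ℕP.≮⇒≥ mid≮p
  ; k≤q = ℕP.≮⇒≥ q≮mid
  ; q<right = subst (λ l → q <ℕ l +ℕ 2 ^ suc h) left≡ q<right
  }
  where
  left≡ : o ≡ 2 ^ h * (2 * c)
  left≡ = trans o≡ ([2p]c≡p[2c] (2 ^ h) c)

2p+p≡3p : ∀ p → 2 * p +ℕ p ≡ 3 * p
2p+p≡3p = solve-∀

splitNode-distances : ∀ {p q k d t} (s : SplitNode p q k) → p +ℕ d ≡ suc q → k +ℕ t ≡ q →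
                      t <ℕ d × d +ℕ t ≤ℕ 3 * 2 ^ SplitNode.level s
splitNode-distances {p} {q} {k} {d} {t} s p+d≡1+q k+t≡q = t<d , d+t≤3P
  where
  open SplitNode s
  open ℕP.≤-Reasoning
  P L : ℕ
  P = 2 ^ level
  L = P * (2 * index)
  k≡L+P : k ≡ L +ℕ P
  k≡L+P = trans node (trans (ℕP.*-suc P (2 * index)) (ℕP.+-comm P L))
  t<d : t <ℕ d
  t<d = ℕP.+-cancelˡ-< k t d (begin-strict
    k +ℕ t   ≡⟨ k+t≡q ⟩
    q        <⟨ ℕP.n<1+n q ⟩
    suc q    ≡⟨ sym p+d≡1+q ⟩
    p +ℕ d   ≤⟨ ℕP.+-monoˡ-≤ d p≤k ⟩
    k +ℕ d   ∎)
  t<P : t <ℕ P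
  t<P = ℕP.+-cancelˡ-< k t P (begin-strict
    k +ℕ t           ≡⟨ k+t≡q ⟩
    q                <⟨ q<right ⟩
    L +ℕ 2 * P       ≡⟨ o+2p≡[o+p]+p L P ⟩
    L +ℕ P +ℕ P      ≡⟨ cong (_+ℕ P) (sym k≡L+P) ⟩
    k +ℕ P           ∎)
  d<2P : d <ℕ 2 * P
  d<2P = ℕP.+-cancelˡ-< L d (2 * P) (begin-strict
    L +ℕ d       <⟨ ℕP.+-monoˡ-< d left<p ⟩
    p +ℕ d       ≡⟨ p+d≡1+q ⟩
    suc q        ≤⟨ q<right ⟩
    L +ℕ 2 * P   ∎)
  d+t≤3P : d +ℕ t ≤ℕ 3 * P
  d+t≤3P = subst (d +ℕ t ≤ℕ_) (2p+p≡3p P) (ℕP.<⇒≤ (ℕP.+-mono-< d<2P t<P))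

u-w≡[u-v]+[v-w] : ∀ u v w → u - w ≡ (u - v) + (v - w)
u-w≡[u-v]+[v-w] = ℤSolver.solve-∀

module _ (a : ℕ → ℤ) {N : ℕ} (step : ∀ m → suc m <ℕ N → ∣ a m - a (suc m) ∣ ≤ℕ 1) where

  ∣a[m]-a[m+t]∣≤t : ∀ m t → m +ℕ t <ℕ N → ∣ a m - a (m +ℕ t) ∣ ≤ℕ t
  ∣a[m]-a[m+t]∣≤t m zero _ rewrite ℕP.+-identityʳ m | ℤP.+-inverseʳ (a m) = z≤n
  ∣a[m]-a[m+t]∣≤t m (suc t) m+t+1<N = begin
    ∣ a m - a (m +ℕ suc t) ∣     ≡⟨ cong (λ j → ∣ a m - a j ∣) (ℕP.+-suc m t) ⟩
    ∣ a m - a (suc (m +ℕ t)) ∣   ≡⟨ cong ∣_∣ (u-w≡[u-v]+[v-w] (a m) (a (m +ℕ t)) _) ⟩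
    ∣ a m - a (m +ℕ t) + (a (m +ℕ t) - a (suc (m +ℕ t))) ∣
                                 ≤⟨ ℤP.∣i+j∣≤∣i∣+∣j∣ (a m - a (m +ℕ t)) _ ⟩
    ∣ a m - a (m +ℕ t) ∣ +ℕ ∣ a (m +ℕ t) - a (suc (m +ℕ t)) ∣
                                 ≤⟨ ℕP.+-mono-≤ (∣a[m]-a[m+t]∣≤t m t m+t<N) (step (m +ℕ t) 1+m+t<N) ⟩
    t +ℕ 1                       ≡⟨ ℕP.+-comm t 1 ⟩
    suc t                        ∎
    where
    open ℕP.≤-Reasoning
    1+m+t<N : suc (m +ℕ t) <ℕ N
    1+m+t<N = subst (_<ℕ N) (ℕP.+-suc m t) m+t+1<N
    m+t<N : m +ℕ t <ℕ N
    m+t<N = ℕP.<-trans (ℕP.n<1+n _) 1+m+t<N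

∣i∣≤t<d⇒0<i+d≤d+t : ∀ i {d t} → ∣ i ∣ ≤ℕ t → t <ℕ d → (+ 0 < i + + d) × (i + + d ≤ + (d +ℕ t))
∣i∣≤t<d⇒0<i+d≤d+t (+ n) {d} {t} n≤t t<d =
  ℤ.+<+ (ℕP.<-≤-trans (ℕP.n≢0⇒n>0 (ℕP.m<n⇒n≢0 t<d)) (ℕP.m≤n+m d n)) ,
  ℤ.+≤+ (subst (_≤ℕ d +ℕ t) (ℕP.+-comm d n) (ℕP.+-monoʳ-≤ d n≤t))
∣i∣≤t<d⇒0<i+d≤d+t ℤ.-[1+ n ] {d} {t} 1+n≤t t<d
  rewrite ℤP.⊖-≥ (ℕP.<⇒≤ (ℕP.≤-<-trans 1+n≤t t<d)) =
  ℤ.+<+ (ℕP.m<n⇒0<n∸m (ℕP.≤-<-trans 1+n≤t t<d)) ,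
  ℤ.+≤+ (ℕP.≤-trans (ℕP.m∸n≤m d (suc n)) (ℕP.m≤m+n d t))

0<u-x≤d+t : ∀ u {v x d t} → v - x ≡ + d → ∣ u - v ∣ ≤ℕ t → t <ℕ d →
            (+ 0 < u - x) × (u - x ≤ + (d +ℕ t))
0<u-x≤d+t u {v} {x} v-x≡d ∣u-v∣≤t t<d
  rewrite u-w≡[u-v]+[v-w] u v x | v-x≡d = ∣i∣≤t<d⇒0<i+d≤d+t (u - v) ∣u-v∣≤t t<d

i-k<j⇒i-j<k : ∀ i j k → i - k < j → i - j < k
i-k<j⇒i-j<k i j k i-k<j = subst₂ _<_ (shift-left i j k) (shift-right j k) (ℤP.+-monoˡ-< (k - j) i-k<j)
  where
  shift-left : ∀ i j k → (i - k) + (k - j) ≡ i - j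
  shift-left = ℤSolver.solve-∀
  shift-right : ∀ j k → j + (k - j) ≡ k
  shift-right = ℤSolver.solve-∀

LCA-BT-nonpos : ∀ h {z} q → z ≤ + 0 → LCA-BT h z q ≡ 0
LCA-BT-nonpos h {+ zero}    q _ = refl
LCA-BT-nonpos h { ℤ.-[1+ _ ]} q _ = refl
LCA-BT-nonpos h {+ suc _}   q (ℤ.+≤+ ())

[i-d]+1≤0 : ∀ {i d} → i <ℕ d → (+ i - + d) + + 1 ≤ + 0
[i-d]+1≤0 {i} {d} i<d =
  subst (_≤ + 0) (sym (shift (+ i) (+ d))) (ℤP.i≤j⇒i-j≤0 (ℤP.i<j⇒suc[i]≤j (ℤ.+<+ i<d)))
  where
  shift : ∀ i d → (i - d) + ℤ.1ℤ ≡ (ℤ.1ℤ + i) - d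
  shift = ℤSolver.solve-∀

[i-d]+1≡1+[i∸d] : ∀ {i d} → d ≤ℕ i → (+ i - + d) + + 1 ≡ + suc (i ∸ d)
[i-d]+1≡1+[i∸d] {i} {d} d≤i =
  trans (cong (_+ + 1) (trans (ℤP.m-n≡m⊖n i d) (ℤP.⊖-≥ d≤i))) (cong +_ (ℕP.+-comm (i ∸ d) 1))

module _ (h : ℕ) (a : ℕ → ℤ) (step : ∀ m → suc m <ℕ 2 ^ h → ∣ a m - a (suc m) ∣ ≤ℕ 1)
         {i : ℕ} (i<n : i <ℕ 2 ^ h) {x : ℤ} {d : ℕ} (ai-x≡d : a i - x ≡ + d) where

  root-bounds : i <ℕ d → a 0 - + 2 ^ h < x → (+ 0 < a 0 - x) × (a 0 - x ≤ + f (2 ^ h) 0)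
  root-bounds i<d a0-n<x =
    proj₁ (0<u-x≤d+t (a 0) ai-x≡d (∣a[m]-a[m+t]∣≤t a step 0 i i<n) i<d) ,
    ℤP.<⇒≤ (i-k<j⇒i-j<k (a 0) x (+ 2 ^ h) a0-n<x)

  splitNode-bounds : ∀ {p k} → SplitNode p i k → p +ℕ d ≡ suc i →
                     (+ 0 < a k - x) × (a k - x ≤ + f (2 ^ h) k)
  splitNode-bounds {k = k} s p+d≡1+i with ℕP.m≤n⇒∃[o]m+o≡n (SplitNode.k≤q s)
  ... | t , k+t≡i with splitNode-distances s p+d≡1+i k+t≡i
  ... | t<d , d+t≤3P = 0<ak-x , ℤP.≤-trans ak-x≤d+t (ℤ.+≤+ (subst (d +ℕ t ≤ℕ_) (sym f[k]≡3P) d+t≤3P))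
    where
    open SplitNode s using (level; index; node)
    ∣ak-ai∣≤t : ∣ a k - a i ∣ ≤ℕ t
    ∣ak-ai∣≤t = subst (λ j → ∣ a k - a j ∣ ≤ℕ t) k+t≡i
                  (∣a[m]-a[m+t]∣≤t a step k t (subst (_<ℕ 2 ^ h) (sym k+t≡i) i<n))
    f[k]≡3P : f (2 ^ h) k ≡ 3 * 2 ^ level
    f[k]≡3P = trans (cong (f (2 ^ h)) node) (f-2^j*[1+2c] (2 ^ h) level index)
    0<ak-x : + 0 < a k - x
    0<ak-x = proj₁ (0<u-x≤d+t (a k) ai-x≡d ∣ak-ai∣≤t t<d)
    ak-x≤d+t : a k - x ≤ + (d +ℕ t)
    ak-x≤d+t = proj₂ (0<u-x≤d+t (a k) ai-x≡d ∣ak-ai∣≤t t<d)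

  LCA-BT-bounds : a 0 - + 2 ^ h < x → 0 <ℕ d →
                  let k = LCA-BT h ((+ i - + d) + + 1) i in
                  (+ 0 < a k - x) × (a k - x ≤ + f (2 ^ h) k)
  LCA-BT-bounds a0-n<x 0<d with i <? d
  ... | yes i<d rewrite LCA-BT-nonpos h i ([i-d]+1≤0 i<d) = root-bounds i<d a0-n<x
  ... | no i≮d rewrite [i-d]+1≡1+[i∸d] (ℕP.≮⇒≥ i≮d) =
    splitNode-bounds (lcaT-splitNode h 0 (sym (ℕP.*-zeroʳ (2 ^ h))) (s≤s z≤n) p≤i i<n)
                     (cong suc (ℕP.m∸n+n≡m d≤i))
    where
    d≤i : d ≤ℕ i
    d≤i = ℕP.≮⇒≥ i≮d
    p≤i : suc (i ∸ d) ≤ℕ i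
    p≤i = ℕP.∸-monoʳ-< 0<d d≤i

claim1 : (h : ℕ) → (a : ℕ → ℤ) →
         (∀ m → suc m Data.Nat.< 2 ^ h → ∣ a m - a (suc m) ∣ ≡ 1) →
         (i : ℕ) → i Data.Nat.< 2 ^ h →
         (x : ℤ) → a 0 - + (2 ^ h) < x → x < a i →
         + f (2 ^ h) i < a i - x →
         let k = LCA-BT h ((+ i - (a i - x)) + + 1) i in
         (+ 0 < a k - x) × (a k - x ≤ + f (2 ^ h) k)
claim1 h a steps i i<n x a0-n<x _ f<ai-x with a i - x in ai-x≡d
claim1 h a steps i i<n x a0-n<x _ (ℤ.+<+ f<d) | + d =
  LCA-BT-bounds h a (λ m lt → ℕP.≤-reflexive (steps m lt)) i<n ai-x≡d a0-n<x (ℕP.≤-<-trans z≤n f<d)
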